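{- Over an alphabet containing at least three distinct characters, there exists an infinite family of strings $T$ (of unboundedly large length and size $\mathsf{e}(T)$) such that, for a character $b$, $\mathsf{e}(bT) - \mathsf{e}(T) = \mathsf{e}(T) - 2$. Consequently the worst-case additive sensitivity of the CDAWG size under left-end insertion is at least $\mathsf{e}-2$.
   Context: Strings are finite sequences of characters from an alphabet $\Sigma$; $\varepsilon$ is the empty string. For a string $T$, $\mathrm{Substr}(T)$ is its set of substrings (including $\varepsilon$). A substring $u$ of $T$ is left-maximal in $T$ if $u$ is a prefix of $T$ or there are distinct characters $c \neq d$ with $cu, du \in \mathrm{Substr}(T)$; it is right-maximal in $T$ if $u$ is a suffix of $T$ or there are distinct characters $c\neq d$ with $uc, ud \in \mathrm{Substr}(T)$. $\mathsf{M}(T)$ is the set of substrings of $T$ that are both left- and right-maximal (it contains $\varepsilon$ and $T$). The compact directed acyclic word graph $\mathrm{CDAWG}(T)$ has exactly one node for each element of $\mathsf{M}(T)$, and the outgoing edges of the node $x$ are in bijection with the characters $c$ such that $xc \in \mathrm{Substr}(T)$. For a string $w$, $d_T(w)$ is the number of distinct characters $c$ with $wc \in \mathrm{Substr}(T)$. The size of the CDAWG is $\mathsf{e}(T) = \sum_{x \in \mathsf{M}(T)} d_T(x)$, its number of edges. -}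

module Defs where

open import Data.List using (List; []; _∷_; _++_; [_]; length)
open import Data.List.Membership.Propositional using (_∈_)
open import Data.List.Relation.Unary.Unique.Propositional using (Unique)
open import Data.Nat using (ℕ)
open import Data.Product using (Σ; ∃; ∃-syntax; _×_; _,_)
open import Data.Sum using (_⊎_)
open import Function.Bundles using (_⇔_)
open import Relation.Binary.PropositionalEquality using (_≡_; _≢_)

module _ {Σc : Set} where

  Substr : List Σc → List Σc → Set
  Substr T u = ∃[ p ] ∃[ s ] T ≡ p ++ (u ++ s)

  IsPrefix : List Σc → List Σc → Set
  IsPrefix T u = ∃[ s ] T ≡ u ++ s

  IsSuffix : List Σc → List Σc → Set
  IsSuffix T u = ∃[ p ] T ≡ p ++ u

  LeftMaximal : List Σc → List Σc → Set
  LeftMaximal T u =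
    IsPrefix T u ⊎ (∃[ c ] ∃[ d ] (c ≢ d × Substr T (c ∷ u) × Substr T (d ∷ u)))

  RightMaximal : List Σc → List Σc → Set
  RightMaximal T u =
    IsSuffix T u ⊎ (∃[ c ] ∃[ d ] (c ≢ d × Substr T (u ++ [ c ]) × Substr T (u ++ [ d ])))

  InM : List Σc → List Σc → Set
  InM T x = Substr T x × LeftMaximal T x × RightMaximal T x

  -- edges of CDAWG(T): pairs (x , c) with x ∈ M(T) and xc ∈ Substr(T).
  -- Their number is Σ_{x ∈ M(T)} d_T(x) = e(T).
  Edge : List Σc → (List Σc × Σc) → Set
  Edge T (x , c) = InM T x × Substr T (x ++ [ c ])

  HasCard : {A : Set} → (A → Set) → ℕ → Set
  HasCard {A} P n = Σ (List A) λ xs → Unique xs × ((y : A) → (y ∈ xs) ⇔ P y) × length xs ≡ n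

  CDAWGSize : List Σc → ℕ → Set
  CDAWGSize T n = HasCard (Edge T) n

-- Take T = (ab)ᵏ c (ab)ᵏ with k = n + 1.  Since c occurs once in T, a factor through c occurs
-- once and has a unique right context, so no CDAWG node containing c has an outgoing edge.  The
-- c-free factors lie inside the alternating words (ab)ᵏ and b(ab)ᵏ, where each letter determines
-- its neighbours; hence two distinct one-letter contexts of such a factor must involve c or an end
-- of the string.  This leaves ε, with 3 edges, and the nodes (ab)ʲ⁺¹ (j < k), each with the edge c
-- and, if j + 1 < k, the edge a: e(T) = 3 + k + n = 2k + 2.  In bT the same edges survive and the
-- strings b(ab)ʲ (j < k) become left-maximal, each with the two edges a and c, so
-- e(bT) = e(T) + 2k = 2 e(T) − 2.  Finally an injective renaming of the three letters into the
-- given alphabet preserves CDAWG sizes.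

module Submission where

open import Data.Empty using (⊥; ⊥-elim)
open import Data.Unit using (⊤)
open import Data.List using (List; []; _∷_; _++_; [_]; _∷ʳ_; length; map; upTo)
open import Data.List.Membership.Propositional using (_∈_)
open import Data.List.Membership.Propositional.Properties
  using (∈-∃++; ∈-++⁺ˡ; ∈-++⁺ʳ; ∈-++⁻; ∈-map⁺; ∈-map⁻; ∈-upTo⁺; ∈-upTo⁻)
open import Data.List.Properties
  using (++-assoc; ++-identityʳ; ++-identityʳ-unique; ++-cancelˡ; length-++; length-++-≤ˡ; length-++-≤ʳ;
         length-map; length-upTo;
         map-++; map-injective; ∷-injective; ∷-injectiveˡ; ∷-injectiveʳ)
open import Data.List.Relation.Unary.All as All using (All; []; _∷_)
open import Data.List.Relation.Unary.All.Properties
  using (¬Any⇒All¬) renaming (++⁺ to All-++⁺; ++⁻ʳ to All-++⁻ʳ)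
open import Data.List.Relation.Unary.Any using (here; there; any?)
open import Data.List.Relation.Unary.AllPairs using ([]; _∷_)
import Data.List.Relation.Unary.Unique.Propositional.Properties as Unique
open import Data.List.Relation.Unary.Linked as Linked using (Linked; []; [-]; _∷_)
open import Data.Nat using (ℕ; zero; suc; _≤_; _<_; _+_; _*_; z≤n; s≤s; s≤s⁻¹)
open import Data.Nat.Tactic.RingSolver using (solve-∀)
open import Data.Nat.Properties
  using (+-comm; *-suc; *-cancelˡ-<; suc-injective; ≤-refl; <⇒≤; 1+n≰n; n≤1+n; m≤m+n; m≤n+m;
         m<n⇒m<1+n; m<1+n⇒m<n∨m≡n; m≤n⇒∃[o]m+o≡n; module ≤-Reasoning)
open import Data.Product using (Σ-syntax; ∃-syntax; ∃₂; _×_; _,_; proj₁; proj₂; map₁; map₂)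
open import Data.Sum using (_⊎_; inj₁; inj₂)
import Data.Sum as Sum
open import Function using (_∘_; id)
open import Function.Bundles using (_⇔_; mk⇔; Equivalence)
open import Function.Definitions using (Injective)
import Function.Properties.Equivalence as ⇔
open import Relation.Binary.PropositionalEquality
  using (_≡_; _≢_; refl; sym; trans; cong; cong₂; subst; ≢-sym; module ≡-Reasoning)
open import Relation.Binary.Definitions using (DecidableEquality)
open import Relation.Nullary using (¬_; yes; no)
open import Relation.Unary using (_∪_; U)

open import Defs

open Equivalence using (to; from)

-- `HasCard` has an implicit alphabet parameter that it never uses; fix it once.
Card : {A : Set} → (A → Set) → ℕ → Set
Card = HasCard {⊤}

Image : {A B : Set} → (A → B) → (A → Set) → B → Set
Image g P y = ∃[ x ] P x × g x ≡ y

module _ {A : Set} {P Q : A → Set} where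

  hasCard-⇔ : ∀ {n} → (∀ x → P x ⇔ Q x) → Card P n → Card Q n
  hasCard-⇔ P⇔Q (xs , xs-unique , xs-mem , xs-len) =
    xs , xs-unique , (λ x → ⇔.trans (xs-mem x) (P⇔Q x)) , xs-len

  hasCard-∪ : ∀ {m n} → (∀ {x} → P x → Q x → ⊥) →
              Card P m → Card Q n → Card (P ∪ Q) (m + n)
  hasCard-∪ disjoint (xs , xs-unique , xs-mem , refl) (ys , ys-unique , ys-mem , refl) =
    xs ++ ys ,
    Unique.++⁺ xs-unique ys-unique (λ (x∈xs , x∈ys) → disjoint (to (xs-mem _) x∈xs) (to (ys-mem _) x∈ys)) ,
    (λ z → mk⇔ (Sum.map (to (xs-mem z)) (to (ys-mem z)) ∘ ∈-++⁻ xs)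
               (Sum.[ ∈-++⁺ˡ ∘ from (xs-mem z) , ∈-++⁺ʳ xs ∘ from (ys-mem z) ])) ,
    length-++ xs

hasCard-image : {A B : Set} {P : A → Set} {g : A → B} {n : ℕ} →
                Injective _≡_ _≡_ g → Card P n → Card (Image g P) n
hasCard-image {g = g} g-inj (xs , xs-unique , xs-mem , xs-len) =
  map g xs , Unique.map⁺ g-inj xs-unique ,
  (λ y → mk⇔ (image⁻ y) (λ { (x , Px , refl) → ∈-map⁺ g (from (xs-mem x) Px) })) ,
  trans (length-map g xs) xs-len
  where
  image⁻ : ∀ y → y ∈ map g xs → Image g _ y
  image⁻ y y∈ with x , x∈xs , refl ← ∈-map⁻ g y∈ = x , to (xs-mem x) x∈xs , refl

hasCard-< : ∀ n → Card (_< n) n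
hasCard-< n = upTo n , Unique.upTo⁺ n , (λ i → mk⇔ ∈-upTo⁻ ∈-upTo⁺) , length-upTo n

module _ {A : Set} where

  prefix⇒substr : ∀ {T u : List A} → IsPrefix T u → Substr T u
  prefix⇒substr (s , T≡) = [] , s , T≡

  prefix-++ : ∀ {X u : List A} Y → IsPrefix X u → IsPrefix (X ++ Y) u
  prefix-++ {u = u} Y (s , refl) = s ++ Y , ++-assoc u s Y

  suffix-++ : ∀ X {Y u : List A} → IsSuffix Y u → IsSuffix (X ++ Y) u
  suffix-++ X {u = u} (p , refl) = X ++ p , sym (++-assoc X p u)

  substr-++ʳ : ∀ X {Y u : List A} → Substr Y u → Substr (X ++ Y) u
  substr-++ʳ X {u = u} (p , s , refl) = X ++ p , s , sym (++-assoc X p (u ++ s))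

  substr-∷ : ∀ {d : A} {T u} → Substr T u → Substr (d ∷ T) u
  substr-∷ {d} = substr-++ʳ [ d ]

  prefix-∷ : ∀ {d : A} {X u} → IsPrefix X u → IsPrefix (d ∷ X) (d ∷ u)
  prefix-∷ {d} = map₂ (cong (d ∷_))

  suffix-∷ : ∀ {d : A} {X u} → IsSuffix X u → IsSuffix (d ∷ X) u
  suffix-∷ {d} = suffix-++ [ d ]

  substr-∷⁻ : ∀ {d e : A} {T u} → d ≢ e → Substr (d ∷ T) (e ∷ u) → Substr T (e ∷ u)
  substr-∷⁻ d≢e ([] , s , T≡) = ⊥-elim (d≢e (∷-injectiveˡ T≡))
  substr-∷⁻ d≢e (_ ∷ p , s , T≡) = p , s , ∷-injectiveʳ T≡

  substr-length : ∀ {T u : List A} → Substr T u → length u ≤ length T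
  substr-length {u = u} (p , s , refl) = begin
    length u              ≤⟨ length-++-≤ˡ u ⟩
    length (u ++ s)       ≤⟨ length-++-≤ʳ (u ++ s) {p} ⟩
    length (p ++ u ++ s)  ∎
    where open ≤-Reasoning

  ¬substr-∷ʳ : ∀ (T : List A) {d} → ¬ Substr T (T ∷ʳ d)
  ¬substr-∷ʳ T {d} T⊒ = 1+n≰n (begin
    suc (length T)    ≡⟨ +-comm 1 (length T) ⟩
    length T + 1      ≡⟨ length-++ T ⟨
    length (T ∷ʳ d)   ≤⟨ substr-length T⊒ ⟩
    length T          ∎)
    where open ≤-Reasoning

  substr-∷ʳ⁻ : ∀ {T x : List A} {d} → Substr T (x ∷ʳ d) → ∃₂ λ p s → T ≡ p ++ x ++ d ∷ s
  substr-∷ʳ⁻ {x = x} {d} (p , s , refl) = p , s , cong (p ++_) (++-assoc x [ d ] s)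

  suffix-∷ʳ-substr : ∀ {X u : List A} {d} Y → IsSuffix X u → Substr (X ++ d ∷ Y) (u ∷ʳ d)
  suffix-∷ʳ-substr {u = u} {d} Y (p , refl) =
    p , Y , trans (++-assoc p u (d ∷ Y)) (cong (p ++_) (sym (++-assoc u [ d ] Y)))

  prefix-∷-substr : ∀ X {Y u : List A} {d} → IsPrefix Y u → Substr (X ++ d ∷ Y) (d ∷ u)
  prefix-∷-substr X (s , refl) = X , s , refl

  []-inM : ∀ (T : List A) → InM T []
  []-inM T = ([] , T , refl) , inj₁ (T , refl) , inj₁ (T , sym (++-identityʳ T))

-- Renaming the alphabet

map-++⁻ : {A B : Set} (f : A → B) (T : List A) (ys : List B) {zs : List B} → map f T ≡ ys ++ zs →
          ∃₂ λ T₁ T₂ → T ≡ T₁ ++ T₂ × map f T₁ ≡ ys × map f T₂ ≡ zs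
map-++⁻ f T [] T≡ = [] , T , refl , refl , T≡
map-++⁻ f (t ∷ T) (y ∷ ys) T≡
  with T₁ , T₂ , refl , refl , refl ← map-++⁻ f T ys (∷-injectiveʳ T≡)
     | refl ← ∷-injectiveˡ T≡
  = t ∷ T₁ , T₂ , refl , refl , refl

map-≡-[-]⁻ : {A B : Set} (f : A → B) {U : List A} {e : B} → map f U ≡ [ e ] → ∃[ d ] U ≡ [ d ] × f d ≡ e
map-≡-[-]⁻ f {[]} ()
map-≡-[-]⁻ f {d ∷ []} refl = d , refl , refl
map-≡-[-]⁻ f {_ ∷ _ ∷ _} ()

module Renaming {A B : Set} {f : A → B} (f-inj : Injective _≡_ _≡_ f) where

  substr-map⁺ : ∀ {T u} → Substr T u → Substr (map f T) (map f u)
  substr-map⁺ {u = u} (p , s , refl) =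
    map f p , map f s , trans (map-++ f p (u ++ s)) (cong (map f p ++_) (map-++ f u s))

  substr-map⁻ : ∀ {T y} → Substr (map f T) y → ∃[ u ] Substr T u × map f u ≡ y
  substr-map⁻ {T} {y} (p , s , T≡)
    with T₁ , T₂ , refl , refl , T₂≡ ← map-++⁻ f T p T≡
    with U₁ , U₂ , refl , refl , refl ← map-++⁻ f T₂ y T₂≡
    = U₁ , (T₁ , U₂ , refl) , refl

  prefix-map⁺ : ∀ {T u} → IsPrefix T u → IsPrefix (map f T) (map f u)
  prefix-map⁺ {u = u} (s , refl) = map f s , map-++ f u s

  suffix-map⁺ : ∀ {T u} → IsSuffix T u → IsSuffix (map f T) (map f u)
  suffix-map⁺ {u = u} (p , refl) = map f p , map-++ f p u

  prefix-map⁻ : ∀ {T u} → IsPrefix (map f T) (map f u) → IsPrefix T u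
  prefix-map⁻ {T} {u} (s , T≡) with T₁ , T₂ , refl , fT₁≡ , _ ← map-++⁻ f T (map f u) T≡
    rewrite map-injective f-inj fT₁≡ = T₂ , refl

  suffix-map⁻ : ∀ {T u} → IsSuffix (map f T) (map f u) → IsSuffix T u
  suffix-map⁻ {T} (p , T≡) with T₁ , T₂ , refl , _ , fT₂≡ ← map-++⁻ f T p T≡
    rewrite map-injective f-inj fT₂≡ = T₁ , refl

  substr-map-∷⁻ : ∀ {T x e} → Substr (map f T) (e ∷ map f x) → ∃[ d ] f d ≡ e × Substr T (d ∷ x)
  substr-map-∷⁻ T⊒ with d ∷ u , T⊒u , fu≡ ← substr-map⁻ T⊒
    with refl , refl ← ∷-injective fu≡ | refl ← map-injective f-inj (∷-injectiveʳ fu≡) = d , refl , T⊒u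

  substr-map-∷ʳ⁻ : ∀ {T x e} → Substr (map f T) (map f x ∷ʳ e) → ∃[ d ] f d ≡ e × Substr T (x ∷ʳ d)
  substr-map-∷ʳ⁻ {x = x} T⊒ with u , T⊒u , fu≡ ← substr-map⁻ T⊒
    with U₁ , U₂ , refl , fU₁≡ , fU₂≡ ← map-++⁻ f u (map f x) fu≡
    with d , refl , fd≡e ← map-≡-[-]⁻ f fU₂≡
    rewrite map-injective f-inj fU₁≡ = d , fd≡e , T⊒u

  substr-map-∷ʳ⁺ : ∀ {T x d} → Substr T (x ∷ʳ d) → Substr (map f T) (map f x ∷ʳ f d)
  substr-map-∷ʳ⁺ {x = x} {d} T⊒ = subst (Substr _) (map-++ f x [ d ]) (substr-map⁺ T⊒)

  ≢-map : ∀ {d d′} → d ≢ d′ → f d ≢ f d′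
  ≢-map d≢d′ = d≢d′ ∘ f-inj

  leftMaximal-map⁺ : ∀ {T x} → LeftMaximal T x → LeftMaximal (map f T) (map f x)
  leftMaximal-map⁺ (inj₁ pre) = inj₁ (prefix-map⁺ pre)
  leftMaximal-map⁺ (inj₂ (d , d′ , d≢d′ , T⊒dx , T⊒d′x)) =
    inj₂ (f d , f d′ , ≢-map d≢d′ , substr-map⁺ T⊒dx , substr-map⁺ T⊒d′x)

  rightMaximal-map⁺ : ∀ {T x} → RightMaximal T x → RightMaximal (map f T) (map f x)
  rightMaximal-map⁺ (inj₁ suf) = inj₁ (suffix-map⁺ suf)
  rightMaximal-map⁺ (inj₂ (d , d′ , d≢d′ , T⊒xd , T⊒xd′)) =
    inj₂ (f d , f d′ , ≢-map d≢d′ , substr-map-∷ʳ⁺ T⊒xd , substr-map-∷ʳ⁺ T⊒xd′)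

  leftMaximal-map⁻ : ∀ {T x} → LeftMaximal (map f T) (map f x) → LeftMaximal T x
  leftMaximal-map⁻ (inj₁ pre) = inj₁ (prefix-map⁻ pre)
  leftMaximal-map⁻ (inj₂ (e , e′ , e≢e′ , T⊒ex , T⊒e′x))
    with d , refl , T⊒dx ← substr-map-∷⁻ T⊒ex | d′ , refl , T⊒d′x ← substr-map-∷⁻ T⊒e′x
    = inj₂ (d , d′ , e≢e′ ∘ cong f , T⊒dx , T⊒d′x)

  rightMaximal-map⁻ : ∀ {T x} → RightMaximal (map f T) (map f x) → RightMaximal T x
  rightMaximal-map⁻ (inj₁ suf) = inj₁ (suffix-map⁻ suf)
  rightMaximal-map⁻ (inj₂ (e , e′ , e≢e′ , T⊒xe , T⊒xe′))
    with d , refl , T⊒xd ← substr-map-∷ʳ⁻ T⊒xe | d′ , refl , T⊒xd′ ← substr-map-∷ʳ⁻ T⊒xe′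
    = inj₂ (d , d′ , e≢e′ ∘ cong f , T⊒xd , T⊒xd′)

  mapEdge : List A × A → List B × B
  mapEdge (x , d) = map f x , f d

  mapEdge-injective : Injective _≡_ _≡_ mapEdge
  mapEdge-injective {x , d} {x′ , d′} eq =
    cong₂ _,_ (map-injective f-inj (cong proj₁ eq)) (f-inj (cong proj₂ eq))

  edge-map⇔ : ∀ T w → Edge (map f T) w ⇔ Image mapEdge (Edge T) w
  edge-map⇔ T w = mk⇔ edge⁻ edge⁺
    where
    edge⁻ : ∀ {w} → Edge (map f T) w → Image mapEdge (Edge T) w
    edge⁻ ((T⊒y , lm , rm) , T⊒ye) with x , T⊒x , refl ← substr-map⁻ T⊒y
      with d , refl , T⊒xd ← substr-map-∷ʳ⁻ T⊒ye
      = (x , d) , ((T⊒x , leftMaximal-map⁻ lm , rightMaximal-map⁻ rm) , T⊒xd) , refl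
    edge⁺ : ∀ {w} → Image mapEdge (Edge T) w → Edge (map f T) w
    edge⁺ (_ , ((T⊒x , lm , rm) , T⊒xd) , refl) =
      (substr-map⁺ T⊒x , leftMaximal-map⁺ lm , rightMaximal-map⁺ rm) , substr-map-∷ʳ⁺ T⊒xd

  cdawgSize-map : ∀ {T n} → CDAWGSize T n → CDAWGSize (map f T) n
  cdawgSize-map {T} e = hasCard-⇔ (λ w → ⇔.sym (edge-map⇔ T w)) (hasCard-image mapEdge-injective e)

-- Words over {a, b, c} with a single c

data Letter : Set where
  a b c : Letter

_≟_ : DecidableEquality Letter
a ≟ a = yes refl
a ≟ b = no λ ()
a ≟ c = no λ ()
b ≟ a = no λ ()
b ≟ b = yes refl
b ≟ c = no λ ()
c ≟ a = no λ ()
c ≟ b = no λ ()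
c ≟ c = yes refl

card-Letter : Card {Letter} U 3
card-Letter =
  a ∷ b ∷ c ∷ [] , ((λ ()) ∷ (λ ()) ∷ []) ∷ ((λ ()) ∷ []) ∷ [] ∷ [] ,
  (λ d → mk⇔ _ (λ _ → every d)) , refl
  where
  every : ∀ d → d ∈ a ∷ b ∷ c ∷ []
  every a = here refl
  every b = there (here refl)
  every c = there (there (here refl))

CFree : List Letter → Set
CFree = All (c ≢_)

cfree-or-split : ∀ x → CFree x ⊎ ∃₂ λ s p → x ≡ s ++ c ∷ p
cfree-or-split x with any? (c ≟_) x
... | yes c∈x = inj₂ (∈-∃++ c∈x)
... | no c∉x = inj₁ (¬Any⇒All¬ x c∉x)

-- `Linked _⇄_ w` says that w alternates between a and b; it constrains only words of length at
-- least 2, which is why `CFree` hypotheses accompany it.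
data _⇄_ : Letter → Letter → Set where
  a⇄b : a ⇄ b
  b⇄a : b ⇄ a

⇄-injectiveˡ : ∀ {d e z} → d ⇄ z → e ⇄ z → d ≡ e
⇄-injectiveˡ a⇄b a⇄b = refl
⇄-injectiveˡ b⇄a b⇄a = refl

⇄-injectiveʳ : ∀ {z d e} → z ⇄ d → z ⇄ e → d ≡ e
⇄-injectiveʳ a⇄b a⇄b = refl
⇄-injectiveʳ b⇄a b⇄a = refl

module _ {A : Set} {R : A → A → Set} where

  linked-++⁻ˡ : ∀ xs {ys} → Linked R (xs ++ ys) → Linked R xs
  linked-++⁻ˡ [] _ = []
  linked-++⁻ˡ (x ∷ []) _ = [-]
  linked-++⁻ˡ (x ∷ y ∷ xs) (Rxy ∷ h) = Rxy ∷ linked-++⁻ˡ (y ∷ xs) h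

  linked-++⁻ʳ : ∀ xs {ys} → Linked R (xs ++ ys) → Linked R ys
  linked-++⁻ʳ [] h = h
  linked-++⁻ʳ (x ∷ xs) h = linked-++⁻ʳ xs (Linked.tail h)

  linked-substr : ∀ {T u} → Substr T u → Linked R T → Linked R u
  linked-substr {u = u} (p , s , refl) h = linked-++⁻ˡ u (linked-++⁻ʳ p h)

  linked-∷-functional : (∀ {d e z} → R d z → R e z → d ≡ e) →
                        ∀ {d e x} → x ≢ [] → Linked R (d ∷ x) → Linked R (e ∷ x) → d ≡ e
  linked-∷-functional R-injˡ {x = []} x≢[] _ _ = ⊥-elim (x≢[] refl)
  linked-∷-functional R-injˡ {x = _ ∷ _} _ (Rdz ∷ _) (Rez ∷ _) = R-injˡ Rdz Rez

  linked-∷ʳ-functional : (∀ {z d e} → R z d → R z e → d ≡ e) →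
                         ∀ {d e} x → x ≢ [] → Linked R (x ∷ʳ d) → Linked R (x ∷ʳ e) → d ≡ e
  linked-∷ʳ-functional R-injʳ [] x≢[] _ _ = ⊥-elim (x≢[] refl)
  linked-∷ʳ-functional R-injʳ (_ ∷ []) _ (Rzd ∷ _) (Rze ∷ _) = R-injʳ Rzd Rze
  linked-∷ʳ-functional R-injʳ (_ ∷ z ∷ x) _ (_ ∷ h) (_ ∷ h′) =
    linked-∷ʳ-functional R-injʳ (z ∷ x) (λ ()) h h′

¬cfree-c : ∀ P {Q} → ¬ CFree (P ++ c ∷ Q)
¬cfree-c P h = All.head (All-++⁻ʳ P h) refl

module _ {Q : List Letter} where

  cfree-prefix⁻ : ∀ P {y} → CFree y → IsPrefix (P ++ c ∷ Q) y → IsPrefix P y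
  cfree-prefix⁻ P {[]} _ _ = P , refl
  cfree-prefix⁻ [] {z ∷ y} (c≢z ∷ _) (_ , T≡) = ⊥-elim (c≢z (∷-injectiveˡ T≡))
  cfree-prefix⁻ (p ∷ P) {z ∷ y} (_ ∷ y-free) (s , T≡) with refl , T≡′ ← ∷-injective T≡ =
    map₂ (cong (p ∷_)) (cfree-prefix⁻ P y-free (s , T≡′))

  cfree-suffix⁻ : ∀ P {y} → CFree y → IsSuffix (P ++ c ∷ Q) y → IsSuffix Q y
  cfree-suffix⁻ P y-free ([] , refl) = ⊥-elim (¬cfree-c P y-free)
  cfree-suffix⁻ [] _ (_ ∷ pre , T≡) = pre , ∷-injectiveʳ T≡
  cfree-suffix⁻ (_ ∷ P) y-free (_ ∷ pre , T≡) = cfree-suffix⁻ P y-free (pre , ∷-injectiveʳ T≡)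

  cfree-substr⁻ : ∀ P {y} → CFree y → Substr (P ++ c ∷ Q) y → Substr P y ⊎ Substr Q y
  cfree-substr⁻ P y-free ([] , s , T≡) = inj₁ (prefix⇒substr (cfree-prefix⁻ P y-free (s , T≡)))
  cfree-substr⁻ [] _ (_ ∷ pre , s , T≡) = inj₂ (pre , s , ∷-injectiveʳ T≡)
  cfree-substr⁻ (_ ∷ P) y-free (_ ∷ pre , s , T≡) =
    Sum.map₁ substr-∷ (cfree-substr⁻ P y-free (pre , s , ∷-injectiveʳ T≡))

  c-occurrence-unique : ∀ P X {Y} → CFree P → CFree Q → P ++ c ∷ Q ≡ X ++ c ∷ Y → P ≡ X × Q ≡ Y
  c-occurrence-unique [] [] _ _ T≡ = refl , ∷-injectiveʳ T≡
  c-occurrence-unique [] (_ ∷ X) _ Q-free T≡ =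
    ⊥-elim (¬cfree-c X (subst CFree (∷-injectiveʳ T≡) Q-free))
  c-occurrence-unique (_ ∷ _) [] (c≢p ∷ _) _ T≡ = ⊥-elim (c≢p (sym (∷-injectiveˡ T≡)))
  c-occurrence-unique (p ∷ P) (_ ∷ X) (_ ∷ P-free) Q-free T≡
    with refl , T≡′ ← ∷-injective T≡ = map₁ (cong (p ∷_)) (c-occurrence-unique P X P-free Q-free T≡′)

module SingleC {P Q : List Letter} (P-free : CFree P) (Q-free : CFree Q) where

  substr-∷ʳc⁻ : ∀ {y} → Substr (P ++ c ∷ Q) (y ∷ʳ c) → IsSuffix P y
  substr-∷ʳc⁻ {y} T⊒ with pre , s , T≡ ← substr-∷ʳ⁻ T⊒ =
    pre , proj₁ (c-occurrence-unique P (pre ++ y) P-free Q-free (trans T≡ (sym (++-assoc pre y (c ∷ s)))))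

  substr-c∷⁻ : ∀ {y} → Substr (P ++ c ∷ Q) (c ∷ y) → IsPrefix Q y
  substr-c∷⁻ (pre , s , T≡) = s , proj₂ (c-occurrence-unique P pre P-free Q-free T≡)

  suffix-through-c : ∀ s₀ p → IsSuffix (P ++ c ∷ Q) (s₀ ++ c ∷ p) → Q ≡ p
  suffix-through-c s₀ p (pre , T≡) =
    proj₂ (c-occurrence-unique P (pre ++ s₀) P-free Q-free (trans T≡ (sym (++-assoc pre s₀ (c ∷ p)))))

  letter-after-c : ∀ s₀ p {d} → Substr (P ++ c ∷ Q) ((s₀ ++ c ∷ p) ∷ʳ d) → ∃[ r ] Q ≡ p ++ d ∷ r
  letter-after-c s₀ p {d} T⊒ with pre , r , T≡ ← substr-∷ʳ⁻ T⊒ =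
    r , proj₂ (c-occurrence-unique P (pre ++ s₀) P-free Q-free (trans T≡ reassoc))
    where
    reassoc : pre ++ (s₀ ++ c ∷ p) ++ d ∷ r ≡ (pre ++ s₀) ++ c ∷ p ++ d ∷ r
    reassoc = trans (cong (pre ++_) (++-assoc s₀ (c ∷ p) (d ∷ r))) (sym (++-assoc pre s₀ _))

  -- c occurs once in P ++ c ∷ Q, so a string through it occurs once and has a unique right context.
  no-edge-through-c : ∀ s₀ p {d} → Substr (P ++ c ∷ Q) ((s₀ ++ c ∷ p) ∷ʳ d) →
                      ¬ RightMaximal (P ++ c ∷ Q) (s₀ ++ c ∷ p)
  no-edge-through-c s₀ p T⊒ (inj₁ suf)
    with r , Q≡ ← letter-after-c s₀ p T⊒
    with () ← ++-identityʳ-unique p (trans (sym (suffix-through-c s₀ p suf)) Q≡)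
  no-edge-through-c s₀ p _ (inj₂ (d₁ , d₂ , d₁≢d₂ , T⊒₁ , T⊒₂))
    with r₁ , Q≡₁ ← letter-after-c s₀ p T⊒₁ | r₂ , Q≡₂ ← letter-after-c s₀ p T⊒₂ =
    d₁≢d₂ (∷-injectiveˡ (++-cancelˡ p _ _ (trans (sym Q≡₁) Q≡₂)))

  module _ (P-linked : Linked _⇄_ P) (Q-linked : Linked _⇄_ Q) where

    cfree-substr-linked : ∀ {y} → CFree y → Substr (P ++ c ∷ Q) y → Linked _⇄_ y
    cfree-substr-linked y-free T⊒ =
      Sum.[ (λ P⊒ → linked-substr P⊒ P-linked) , (λ Q⊒ → linked-substr Q⊒ Q-linked) ]
        (cfree-substr⁻ P y-free T⊒)

    leftMaximal⁻ : ∀ {x} → CFree x → x ≢ [] → LeftMaximal (P ++ c ∷ Q) x → IsPrefix P x ⊎ IsPrefix Q x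
    leftMaximal⁻ x-free _ (inj₁ pre) = inj₁ (cfree-prefix⁻ P x-free pre)
    leftMaximal⁻ x-free x≢[] (inj₂ (d , e , d≢e , T⊒dx , T⊒ex)) with c ≟ d | c ≟ e
    ... | yes refl | _ = inj₂ (substr-c∷⁻ T⊒dx)
    ... | no _ | yes refl = inj₂ (substr-c∷⁻ T⊒ex)
    ... | no c≢d | no c≢e = ⊥-elim (d≢e (linked-∷-functional ⇄-injectiveˡ x≢[]
            (cfree-substr-linked (c≢d ∷ x-free) T⊒dx) (cfree-substr-linked (c≢e ∷ x-free) T⊒ex)))

    rightMaximal⁻ : ∀ {x} → CFree x → x ≢ [] → RightMaximal (P ++ c ∷ Q) x →
                    IsSuffix Q x ⊎ (IsSuffix P x × ∃[ d ] c ≢ d × Substr (P ++ c ∷ Q) (x ∷ʳ d))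
    rightMaximal⁻ x-free _ (inj₁ suf) = inj₁ (cfree-suffix⁻ P x-free suf)
    rightMaximal⁻ {x} x-free x≢[] (inj₂ (d , e , d≢e , T⊒xd , T⊒xe)) with c ≟ d | c ≟ e
    ... | yes refl | _ = inj₂ (substr-∷ʳc⁻ T⊒xd , e , d≢e , T⊒xe)
    ... | no c≢d | yes refl = inj₂ (substr-∷ʳc⁻ T⊒xe , d , ≢-sym d≢e , T⊒xd)
    ... | no c≢d | no c≢e = ⊥-elim (d≢e (linked-∷ʳ-functional ⇄-injectiveʳ x x≢[]
            (cfree-substr-linked (All-++⁺ x-free (c≢d ∷ [])) T⊒xd)
            (cfree-substr-linked (All-++⁺ x-free (c≢e ∷ [])) T⊒xe)))

ab^_ : ℕ → List Letter
ab^ zero = []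
ab^ suc k = a ∷ b ∷ ab^ k

ab^-injective : Injective _≡_ _≡_ ab^_
ab^-injective {zero} {zero} _ = refl
ab^-injective {suc i} {suc j} eq = cong suc (ab^-injective (∷-injectiveʳ (∷-injectiveʳ eq)))

ab^-+ : ∀ m n → ab^ (m + n) ≡ ab^ m ++ ab^ n
ab^-+ zero n = refl
ab^-+ (suc m) n = cong (λ w → a ∷ b ∷ w) (ab^-+ m n)

length-ab^ : ∀ k → length (ab^ k) ≡ 2 * k
length-ab^ zero = refl
length-ab^ (suc k) = trans (cong (2 +_) (length-ab^ k)) (sym (*-suc 2 k))

ab^-cfree : ∀ k → CFree (ab^ k)
ab^-cfree zero = []
ab^-cfree (suc k) = (λ ()) ∷ (λ ()) ∷ ab^-cfree k

b∷ab^-linked : ∀ k → Linked _⇄_ (b ∷ ab^ k)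
b∷ab^-linked zero = [-]
b∷ab^-linked (suc k) = b⇄a ∷ a⇄b ∷ b∷ab^-linked k

ab^-linked : ∀ k → Linked _⇄_ (ab^ k)
ab^-linked k = Linked.tail (b∷ab^-linked k)

ab^∷ʳb-unlinked : ∀ j → ¬ Linked _⇄_ (ab^ suc j ∷ʳ b)
ab^∷ʳb-unlinked zero (_ ∷ () ∷ _)
ab^∷ʳb-unlinked (suc j) (_ ∷ _ ∷ h) = ab^∷ʳb-unlinked j h

b∷ab^∷ʳb-unlinked : ∀ j → ¬ Linked _⇄_ (b ∷ ab^ j ∷ʳ b)
b∷ab^∷ʳb-unlinked zero (() ∷ _)
b∷ab^∷ʳb-unlinked (suc j) (_ ∷ h) = ab^∷ʳb-unlinked j h

ab^-prefix : ∀ {j k} → j ≤ k → IsPrefix (ab^ k) (ab^ j)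
ab^-prefix z≤n = _ , refl
ab^-prefix (s≤s j≤k) = map₂ (cong (λ w → a ∷ b ∷ w)) (ab^-prefix j≤k)

ab^∷ʳa-prefix : ∀ {j k} → j < k → IsPrefix (ab^ k) (ab^ j ∷ʳ a)
ab^∷ʳa-prefix {zero} (s≤s _) = _ , refl
ab^∷ʳa-prefix {suc j} (s≤s j<k) = map₂ (cong (λ w → a ∷ b ∷ w)) (ab^∷ʳa-prefix j<k)

prefix-ab^-head : ∀ k {d y} → IsPrefix (ab^ k) (d ∷ y) → d ≡ a
prefix-ab^-head zero (_ , ())
prefix-ab^-head (suc k) (_ , ab^k≡) = sym (∷-injectiveˡ ab^k≡)

ab^-suffix : ∀ {j k} → j ≤ k → IsSuffix (ab^ k) (ab^ j)
ab^-suffix {j} j≤k with o , refl ← m≤n⇒∃[o]m+o≡n j≤k =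
  ab^ o , trans (cong ab^_ (+-comm j o)) (ab^-+ o j)

b∷ab^-suffix : ∀ {j k} → j < k → IsSuffix (ab^ k) (b ∷ ab^ j)
b∷ab^-suffix {j} j<k with p , ab^k≡ ← ab^-suffix j<k =
  p ∷ʳ a , trans ab^k≡ (sym (++-assoc p [ a ] (b ∷ ab^ j)))

ab^∷ʳa-substr-< : ∀ {j k} → Substr (ab^ k) (ab^ j ∷ʳ a) → j < k
ab^∷ʳa-substr-< {j} {k} ab^k⊒ = *-cancelˡ-< 2 j k (begin
  suc (2 * j)             ≡⟨ cong suc (length-ab^ j) ⟨
  suc (length (ab^ j))    ≡⟨ +-comm 1 _ ⟩
  length (ab^ j) + 1      ≡⟨ length-++ (ab^ j) ⟨
  length (ab^ j ∷ʳ a)     ≤⟨ substr-length ab^k⊒ ⟩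
  length (ab^ k)          ≡⟨ length-ab^ k ⟩
  2 * k                   ∎)
  where open ≤-Reasoning

AbSuffix : ℕ → List Letter → Set
AbSuffix k x = (∃[ j ] j < k × x ≡ ab^ suc j) ⊎ (∃[ j ] j < k × x ≡ b ∷ ab^ j)

suffix-ab^⁻ : ∀ k {x} → x ≢ [] → IsSuffix (ab^ k) x → AbSuffix k x
suffix-ab^⁻ zero x≢[] ([] , refl) = ⊥-elim (x≢[] refl)
suffix-ab^⁻ (suc k) _ ([] , refl) = inj₁ (k , ≤-refl , refl)
suffix-ab^⁻ (suc k) _ (_ ∷ [] , refl) = inj₂ (k , ≤-refl , refl)
suffix-ab^⁻ (suc k) x≢[] (_ ∷ _ ∷ p , ab^k≡) =
  Sum.map (map₂ (map₁ m<n⇒m<1+n)) (map₂ (map₁ m<n⇒m<1+n))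
    (suffix-ab^⁻ k x≢[] (p , ∷-injectiveʳ (∷-injectiveʳ ab^k≡)))

-- The family T = (ab)ᵏ c (ab)ᵏ and its extension bT

module Family (n : ℕ) where

  k : ℕ
  k = suc n

  T : List Letter
  T = ab^ k ++ c ∷ ab^ k

  rootEdge : Letter → List Letter × Letter
  rootEdge d = [] , d

  abEdge : Letter → ℕ → List Letter × Letter
  abEdge d j = ab^ suc j , d

  babEdge : Letter → ℕ → List Letter × Letter
  babEdge d j = b ∷ ab^ j , d

  AbEdge TEdge NewEdge : List Letter × Letter → Set
  AbEdge = Image (abEdge c) (_< k) ∪ Image (abEdge a) (_< n)
  TEdge = Image rootEdge U ∪ AbEdge
  NewEdge = Image (babEdge c) (_< k) ∪ Image (babEdge a) (_< k)

  abEdge-injective : ∀ d → Injective _≡_ _≡_ (abEdge d)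
  abEdge-injective d eq = suc-injective (ab^-injective (cong proj₁ eq))

  babEdge-injective : ∀ d → Injective _≡_ _≡_ (babEdge d)
  babEdge-injective d eq = ab^-injective (∷-injectiveʳ (cong proj₁ eq))

  card-TEdge : Card TEdge (3 + (k + n))
  card-TEdge =
    hasCard-∪ (λ { (_ , _ , refl) (inj₁ (_ , _ , ())) ; (_ , _ , refl) (inj₂ (_ , _ , ())) })
      (hasCard-image (cong proj₂) card-Letter)
      (hasCard-∪ (λ { (_ , _ , refl) (_ , _ , ()) })
        (hasCard-image (abEdge-injective c) (hasCard-< k))
        (hasCard-image (abEdge-injective a) (hasCard-< n)))

  card-NewEdge : Card NewEdge (k + k)
  card-NewEdge =
    hasCard-∪ (λ { (_ , _ , refl) (_ , _ , ()) })
      (hasCard-image (babEdge-injective c) (hasCard-< k))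
      (hasCard-image (babEdge-injective a) (hasCard-< k))

  TEdge-NewEdge-disjoint : ∀ {v} → TEdge v → NewEdge v → ⊥
  TEdge-NewEdge-disjoint (inj₁ (_ , _ , refl)) (inj₁ (_ , _ , ()))
  TEdge-NewEdge-disjoint (inj₁ (_ , _ , refl)) (inj₂ (_ , _ , ()))
  TEdge-NewEdge-disjoint (inj₂ (inj₁ (_ , _ , refl))) (inj₁ (_ , _ , ()))
  TEdge-NewEdge-disjoint (inj₂ (inj₁ (_ , _ , refl))) (inj₂ (_ , _ , ()))
  TEdge-NewEdge-disjoint (inj₂ (inj₂ (_ , _ , refl))) (inj₁ (_ , _ , ()))
  TEdge-NewEdge-disjoint (inj₂ (inj₂ (_ , _ , refl))) (inj₂ (_ , _ , ()))

  root-extension : ∀ d → Substr T [ d ]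
  root-extension a = [] , _ , refl
  root-extension b = [ a ] , _ , refl
  root-extension c = ab^ k , ab^ k , refl

  ab^∷ʳa-substr : ∀ P {j} → j < n → Substr (P ++ c ∷ ab^ k) (ab^ suc j ∷ʳ a)
  ab^∷ʳa-substr P j<n = substr-++ʳ P (substr-∷ (prefix⇒substr (ab^∷ʳa-prefix (s≤s j<n))))

  ab^-rightMaximal : ∀ P {j} → IsSuffix P (ab^ suc j) → j < k → RightMaximal (P ++ c ∷ ab^ k) (ab^ suc j)
  ab^-rightMaximal P P⊐ j<k with m<1+n⇒m<n∨m≡n j<k
  ... | inj₂ refl = inj₁ (suffix-++ P ([ c ] , refl))
  ... | inj₁ j<n = inj₂ (a , c , (λ ()) , ab^∷ʳa-substr P j<n , suffix-∷ʳ-substr (ab^ k) P⊐)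

  ab^-inM-T : ∀ {j} → j < k → InM T (ab^ suc j)
  ab^-inM-T {j} j<k = prefix⇒substr pre , inj₁ pre , ab^-rightMaximal (ab^ k) (ab^-suffix j<k) j<k
    where
    pre : IsPrefix T (ab^ suc j)
    pre = prefix-++ (c ∷ ab^ k) (ab^-prefix j<k)

  ab^-inM-bT : ∀ {j} → j < k → InM (b ∷ T) (ab^ suc j)
  ab^-inM-bT j<k =
    substr-∷ (proj₁ (ab^-inM-T j<k)) ,
    inj₂ (c , b , (λ ()) , prefix-∷-substr (b ∷ ab^ k) (ab^-prefix j<k) ,
          prefix⇒substr (prefix-++ (c ∷ ab^ k) (prefix-∷ (ab^-prefix j<k)))) ,
    ab^-rightMaximal (b ∷ ab^ k) (suffix-∷ (ab^-suffix j<k)) j<k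

  b∷ab^∷ʳa-substr : ∀ {j} → j < k → Substr (b ∷ T) (b ∷ ab^ j ∷ʳ a)
  b∷ab^∷ʳa-substr j<k = prefix⇒substr (prefix-++ (c ∷ ab^ k) (prefix-∷ (ab^∷ʳa-prefix j<k)))

  b∷ab^-inM : ∀ {j} → j < k → InM (b ∷ T) (b ∷ ab^ j)
  b∷ab^-inM {j} j<k =
    prefix⇒substr pre , inj₁ pre ,
    inj₂ (a , c , (λ ()) , b∷ab^∷ʳa-substr j<k , suffix-∷ʳ-substr (ab^ k) (suffix-∷ (b∷ab^-suffix j<k)))
    where
    pre : IsPrefix (b ∷ T) (b ∷ ab^ j)
    pre = prefix-++ (c ∷ ab^ k) (prefix-∷ (ab^-prefix (<⇒≤ j<k)))

  edge-T⁺ : ∀ {v} → TEdge v → Edge T v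
  edge-T⁺ (inj₁ (d , _ , refl)) = []-inM T , root-extension d
  edge-T⁺ (inj₂ (inj₁ (j , j<k , refl))) = ab^-inM-T j<k , suffix-∷ʳ-substr (ab^ k) (ab^-suffix j<k)
  edge-T⁺ (inj₂ (inj₂ (j , j<n , refl))) = ab^-inM-T (m<n⇒m<1+n j<n) , ab^∷ʳa-substr (ab^ k) j<n

  edge-bT⁺ : ∀ {v} → (TEdge ∪ NewEdge) v → Edge (b ∷ T) v
  edge-bT⁺ (inj₁ (inj₁ (d , _ , refl))) = []-inM (b ∷ T) , substr-∷ (root-extension d)
  edge-bT⁺ (inj₁ (inj₂ (inj₁ (j , j<k , refl)))) =
    ab^-inM-bT j<k , suffix-∷ʳ-substr (ab^ k) (suffix-∷ (ab^-suffix j<k))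
  edge-bT⁺ (inj₁ (inj₂ (inj₂ (j , j<n , refl)))) =
    ab^-inM-bT (m<n⇒m<1+n j<n) , ab^∷ʳa-substr (b ∷ ab^ k) j<n
  edge-bT⁺ (inj₂ (inj₁ (j , j<k , refl))) =
    b∷ab^-inM j<k , suffix-∷ʳ-substr (ab^ k) (suffix-∷ (b∷ab^-suffix j<k))
  edge-bT⁺ (inj₂ (inj₂ (j , j<k , refl))) = b∷ab^-inM j<k , b∷ab^∷ʳa-substr j<k

  private
    module ST = SingleC (ab^-cfree k) (ab^-cfree k)
    module SbT = SingleC {b ∷ ab^ k} ((λ ()) ∷ ab^-cfree k) (ab^-cfree k)
    ab^k-linked : Linked _⇄_ (ab^ k)
    ab^k-linked = ab^-linked k

  cfree-substr-bT⁻ : ∀ {y} → CFree y → Substr (b ∷ T) y → Substr (b ∷ ab^ k) y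
  cfree-substr-bT⁻ y-free T⊒ = Sum.[ id , substr-∷ ] (cfree-substr⁻ (b ∷ ab^ k) y-free T⊒)

  cfree-substr-bT-linked : ∀ {y} → CFree y → Substr (b ∷ T) y → Linked _⇄_ y
  cfree-substr-bT-linked = SbT.cfree-substr-linked (b∷ab^-linked k) ab^k-linked

  ab^-extension : ∀ {j d} → j < k → Substr (b ∷ T) (ab^ suc j ∷ʳ d) → AbEdge (ab^ suc j , d)
  ab^-extension {j} {a} _ T⊒ = inj₂ (j , s≤s⁻¹ (ab^∷ʳa-substr-< (substr-∷⁻ (λ ()) ab^k⊒)) , refl)
    where
    ab^k⊒ : Substr (b ∷ ab^ k) (ab^ suc j ∷ʳ a)
    ab^k⊒ = cfree-substr-bT⁻ (All-++⁺ (ab^-cfree (suc j)) ((λ ()) ∷ [])) T⊒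
  ab^-extension {j} {b} _ T⊒ =
    ⊥-elim (ab^∷ʳb-unlinked j
      (cfree-substr-bT-linked (All-++⁺ (ab^-cfree (suc j)) ((λ ()) ∷ [])) T⊒))
  ab^-extension {j} {c} j<k _ = inj₁ (j , j<k , refl)

  b∷ab^-extension : ∀ {j d} → j < k → Substr (b ∷ T) (b ∷ ab^ j ∷ʳ d) → NewEdge (b ∷ ab^ j , d)
  b∷ab^-extension {j} {a} j<k _ = inj₂ (j , j<k , refl)
  b∷ab^-extension {j} {b} _ T⊒ =
    ⊥-elim (b∷ab^∷ʳb-unlinked j
      (cfree-substr-bT-linked ((λ ()) ∷ All-++⁺ (ab^-cfree j) ((λ ()) ∷ [])) T⊒))
  b∷ab^-extension {j} {c} j<k _ = inj₁ (j , j<k , refl)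

  ¬substr-b∷ab^k∷ʳ : ∀ {d} → c ≢ d → ¬ Substr (b ∷ T) (b ∷ ab^ k ∷ʳ d)
  ¬substr-b∷ab^k∷ʳ c≢d T⊒ =
    ¬substr-∷ʳ (b ∷ ab^ k) (cfree-substr-bT⁻ ((λ ()) ∷ All-++⁺ (ab^-cfree k) (c≢d ∷ [])) T⊒)

  node-T : ∀ {x} → CFree x → x ≢ [] → LeftMaximal T x → RightMaximal T x → ∃[ j ] j < k × x ≡ ab^ suc j
  node-T x-free x≢[] lm rm
    with suffix-ab^⁻ k x≢[] (Sum.[ id , proj₁ ] (ST.rightMaximal⁻ ab^k-linked ab^k-linked x-free x≢[] rm))
  ... | inj₁ node = node
  ... | inj₂ (j , _ , refl)
    with () ← prefix-ab^-head k (Sum.reduce (ST.leftMaximal⁻ ab^k-linked ab^k-linked x-free x≢[] lm))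

  node-bT : ∀ {x} → CFree x → x ≢ [] → RightMaximal (b ∷ T) x → AbSuffix k x
  node-bT x-free x≢[] rm with SbT.rightMaximal⁻ (b∷ab^-linked k) ab^k-linked x-free x≢[] rm
  ... | inj₁ suf = suffix-ab^⁻ k x≢[] suf
  ... | inj₂ (([] , refl) , d , c≢d , T⊒) = ⊥-elim (¬substr-b∷ab^k∷ʳ c≢d T⊒)
  ... | inj₂ ((_ ∷ p , P≡) , _) = suffix-ab^⁻ k x≢[] (p , ∷-injectiveʳ P≡)

  edge-T⁻ : ∀ v → Edge T v → TEdge v
  edge-T⁻ (x , d) ((_ , _ , rm) , T⊒) with cfree-or-split x
  ... | inj₂ (s , p , refl) = ⊥-elim (ST.no-edge-through-c s p T⊒ rm)
  edge-T⁻ ([] , d) _ | inj₁ _ = inj₁ (d , _ , refl)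
  edge-T⁻ (x@(_ ∷ _) , d) ((_ , lm , rm) , T⊒) | inj₁ x-free with node-T x-free (λ ()) lm rm
  ... | j , j<k , refl = inj₂ (ab^-extension j<k (substr-∷ T⊒))

  edge-bT⁻ : ∀ v → Edge (b ∷ T) v → (TEdge ∪ NewEdge) v
  edge-bT⁻ (x , d) ((_ , _ , rm) , T⊒) with cfree-or-split x
  ... | inj₂ (s , p , refl) = ⊥-elim (SbT.no-edge-through-c s p T⊒ rm)
  edge-bT⁻ ([] , d) _ | inj₁ _ = inj₁ (inj₁ (d , _ , refl))
  edge-bT⁻ (x@(_ ∷ _) , d) ((_ , _ , rm) , T⊒) | inj₁ x-free with node-bT x-free (λ ()) rm
  ... | inj₁ (j , j<k , refl) = inj₁ (inj₂ (ab^-extension j<k T⊒))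
  ... | inj₂ (j , j<k , refl) = inj₂ (b∷ab^-extension j<k T⊒)

  cdawgSize-T : CDAWGSize T (3 + (k + n))
  cdawgSize-T = hasCard-⇔ (λ v → mk⇔ edge-T⁺ (edge-T⁻ v)) card-TEdge

  cdawgSize-bT : CDAWGSize (b ∷ T) (3 + (k + n) + (k + k))
  cdawgSize-bT =
    hasCard-⇔ (λ v → mk⇔ edge-bT⁺ (edge-bT⁻ v))
      (hasCard-∪ TEdge-NewEdge-disjoint card-TEdge card-NewEdge)

  n≤length-T : n ≤ length T
  n≤length-T = begin
    n                ≤⟨ m≤m+n n _ ⟩
    2 * n            ≡⟨ length-ab^ n ⟨
    length (ab^ n)   ≤⟨ substr-length (prefix⇒substr (prefix-++ (c ∷ ab^ k) (ab^-prefix (n≤1+n n)))) ⟩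
    length T         ∎
    where open ≤-Reasoning

edge-count-identity : ∀ n → let e = 3 + (suc n + n) in e + (suc n + suc n) + 2 ≡ e + e
edge-count-identity = solve-∀

module Embedding {Σc : Set} {a₁ a₂ a₃ : Σc}
                 (a₁≢a₂ : a₁ ≢ a₂) (a₁≢a₃ : a₁ ≢ a₃) (a₂≢a₃ : a₂ ≢ a₃) where

  letter : Letter → Σc
  letter a = a₁
  letter b = a₂
  letter c = a₃

  letter-injective : Injective _≡_ _≡_ letter
  letter-injective {a} {a} _ = refl
  letter-injective {a} {b} eq = ⊥-elim (a₁≢a₂ eq)
  letter-injective {a} {c} eq = ⊥-elim (a₁≢a₃ eq)
  letter-injective {b} {a} eq = ⊥-elim (a₁≢a₂ (sym eq))
  letter-injective {b} {b} _ = refl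
  letter-injective {b} {c} eq = ⊥-elim (a₂≢a₃ eq)
  letter-injective {c} {a} eq = ⊥-elim (a₁≢a₃ (sym eq))
  letter-injective {c} {b} eq = ⊥-elim (a₂≢a₃ (sym eq))
  letter-injective {c} {c} _ = refl

theorem2 : {Σc : Set} → (a₁ a₂ a₃ : Σc) → a₁ ≢ a₂ → a₁ ≢ a₃ → a₂ ≢ a₃ →
    (N : ℕ) → Σ[ T ∈ List Σc ] Σ[ b ∈ Σc ] ∃[ e ] ∃[ e' ]
      (CDAWGSize T e × CDAWGSize (b ∷ T) e' × N ≤ length T × N ≤ e × e' + 2 ≡ e + e)
theorem2 a₁ a₂ a₃ a₁≢a₂ a₁≢a₃ a₂≢a₃ N =
  map letter T , a₂ , _ , _ ,
  cdawgSize-map cdawgSize-T , cdawgSize-map cdawgSize-bT ,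
  subst (N ≤_) (sym (length-map letter T)) n≤length-T , m≤n+m N (3 + suc N) , edge-count-identity N
  where
  open Family N
  open Embedding a₁≢a₂ a₁≢a₃ a₂≢a₃
  open Renaming letter-injective
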